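{- Let $\mathcal T$ be a tower diagram and $\alpha$ a positive integer. Then either both iterated slides $\alpha^{\searrow}((\alpha+1)^{\searrow}(\alpha^{\searrow}\mathcal T))$ and $(\alpha+1)^{\searrow}(\alpha^{\searrow}((\alpha+1)^{\searrow}\mathcal T))$ are defined and $$\alpha^{\searrow}((\alpha+1)^{\searrow}(\alpha^{\searrow}\mathcal T))=(\alpha+1)^{\searrow}(\alpha^{\searrow}((\alpha+1)^{\searrow}\mathcal T)),$$ or both of them terminate.
   Context: A cell is a pair $(i,j)$ of integers with $i\ge 1$, $j\ge 0$. A tower diagram is a finite set $\mathcal T$ of cells such that $(i,j)\in\mathcal T$ and $0\le k\le j$ imply $(i,k)\in\mathcal T$. The cell $(i,j)$ lies on the diagonal $x+y=i+j$. Sliding: for a positive integer $\alpha$, the slide $\alpha^{\searrow}\mathcal T$ is either a tower diagram or terminates (without result); it is computed by the procedure $P(\gamma,m)$ started at $\gamma=\alpha$, $m=1$: (S1) if no cell $(i,j)\in\mathcal T$ with $i\ge m$ lies on the diagonal $x+y=\gamma-1$, then: (a) if $(\gamma,0)\notin\mathcal T$ the result is $\mathcal T\cup\{(\gamma,0)\}$; (b) if $(\gamma,0)\in\mathcal T$ and $(\gamma,1)\notin\mathcal T$ the slide terminates; (c) if $(\gamma,0),(\gamma,1)\in\mathcal T$, continue with $P(\gamma+1,\gamma+1)$. (S2) Otherwise let $i\ge m$ be the smallest index with $(i,\gamma-1-i)\in\mathcal T$; then: (a) if $(i,\gamma-i)\notin\mathcal T$ the result is $\mathcal T\cup\{(i,\gamma-i)\}$;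 (b) if $(i,\gamma-i)\in\mathcal T$ and $(i,\gamma-i+1)\notin\mathcal T$ the slide terminates; (c) if $(i,\gamma-i),(i,\gamma-i+1)\in\mathcal T$, continue with $P(\gamma+1,i+1)$. An iterated slide terminates if any of its individual slides terminates. -}

module Defs where

open import Data.Nat using (ℕ; zero; suc; _+_; _≤_; _<_)
open import Data.Product using (_×_; _,_)
open import Data.List using (List; []; _∷_)
open import Data.List.Membership.Propositional using (_∈_; _∉_)
open import Relation.Binary.PropositionalEquality using (_≡_)
open import Function.Bundles using (_⇔_)

-- A cell (i , j); a tower diagram is given by a finite list of cells,
-- viewed as the finite set of its members.
Cell : Set
Cell = ℕ × ℕ

Diagram : Set
Diagram = List Cell

IsTowerDiagram : Diagram → Set
IsTowerDiagram T =
  (∀ i j → (i , j) ∈ T → 1 ≤ i) ×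
  (∀ i j k → (i , j) ∈ T → k ≤ j → (i , k) ∈ T)

_≐_ : Diagram → Diagram → Set
A ≐ B = ∀ c → (c ∈ A) ⇔ (c ∈ B)

-- Outcome of a slide: a resulting diagram, or termination (no result).
data Outcome : Set where
  done  : Diagram → Outcome
  stuck : Outcome

NoDiag : Diagram → ℕ → ℕ → Set
NoDiag T γ m = ∀ i j → m ≤ i → suc (i + j) ≡ γ → (i , j) ∉ T

FirstDiag : Diagram → ℕ → ℕ → ℕ → ℕ → Set
FirstDiag T γ m i j =
  m ≤ i × suc (i + j) ≡ γ × (i , j) ∈ T ×
  (∀ i' j' → m ≤ i' → i' < i → suc (i' + j') ≡ γ → (i' , j') ∉ T)

-- The procedure P(γ, m) on T, as an inductive relation to its outcome.
-- In S2, j = γ-1-i, so (i, γ-i) = (i, j+1) and (i, γ-i+1) = (i, j+2).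
data P (T : Diagram) : ℕ → ℕ → Outcome → Set where
  s1a : ∀ {γ m} → NoDiag T γ m → (γ , 0) ∉ T →
        P T γ m (done ((γ , 0) ∷ T))
  s1b : ∀ {γ m} → NoDiag T γ m → (γ , 0) ∈ T → (γ , 1) ∉ T →
        P T γ m stuck
  s1c : ∀ {γ m o} → NoDiag T γ m → (γ , 0) ∈ T → (γ , 1) ∈ T →
        P T (suc γ) (suc γ) o → P T γ m o
  s2a : ∀ {γ m i j} → FirstDiag T γ m i j → (i , suc j) ∉ T →
        P T γ m (done ((i , suc j) ∷ T))
  s2b : ∀ {γ m i j} → FirstDiag T γ m i j → (i , suc j) ∈ T →
        (i , suc (suc j)) ∉ T → P T γ m stuck
  s2c : ∀ {γ m i j o} → FirstDiag T γ m i j → (i , suc j) ∈ T →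
        (i , suc (suc j)) ∈ T → P T (suc γ) (suc i) o → P T γ m o

Slide : ℕ → Diagram → Outcome → Set
Slide α T o = P T α 1 o

-- Iterated slides: Slides (α₁ ∷ α₂ ∷ …) T o means α₁ is applied first,
-- then α₂, …; the iterated slide terminates if any single slide does.
data Slides : List ℕ → Diagram → Outcome → Set where
  nil     : ∀ {T} → Slides [] T (done T)
  consOk  : ∀ {α as T T' o} → Slide α T (done T') → Slides as T' o →
            Slides (α ∷ as) T o
  consStop : ∀ {α as T} → Slide α T stuck → Slides (α ∷ as) T stuck

-- A slide reads the diagram column by column, and column m (of height h)
-- meets the diagonal of γ exactly when γ ≤ h + m. In column m the slide γ
-- therefore skips the column if h + m < γ, adds the cell (m , h) if
-- h + m = γ, terminates if h + m = γ + 1, and passes on to column m + 1 with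
-- γ + 1 if h + m ≥ γ + 2, without touching column m. Comparing h + m with α:
-- if all six slides skip column m (h + m < α) or pass it (h + m ≥ α + 3),
-- the claim reduces to the same claim started in column m + 1; otherwise a
-- direct computation settles it, the only nontrivial case being h + m = α,
-- where both orders add (m , h), (m , h + 1) and the cell that α + 1 adds to
-- T beyond column m.
module Submission where

open import Defs
open import Data.Nat using (ℕ; zero; suc; _+_; _∸_; _≤_; _<_; z≤n; s≤s; z<s; _⊔_; _≟_)
open import Data.Nat.Properties
open import Data.Product using (Σ; ∃; ∃₂; _×_; _,_; proj₁; proj₂)
open import Data.Product.Properties using (≡-dec)
open import Data.Sum using (_⊎_; inj₁; inj₂)
open import Data.List using (_∷_; [])
open import Data.List.Relation.Unary.Any using (here; there)
open import Data.List.Membership.Propositional using (_∈_; _∉_)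
open import Data.List.Membership.DecPropositional (≡-dec _≟_ _≟_) using (_∈?_)
open import Data.List.Relation.Binary.Permutation.Propositional using (_↭_; ↭-sym)
open import Data.List.Relation.Binary.Permutation.Propositional.Properties
  using (∈-resp-↭; shift)
open import Data.Maybe using (Maybe; just; nothing)
open import Data.Empty using (⊥-elim)
open import Relation.Nullary using (yes; no)
open import Relation.Binary.PropositionalEquality using (_≡_; _≢_; refl; sym; cong; subst)
open import Relation.Binary.Definitions using (tri<; tri≈; tri>)
open import Function.Bundles using (mk⇔)

data Adds (T : Diagram) : ℕ → ℕ → Maybe Cell → Set where
  s1a : ∀ {γ m} → NoDiag T γ m → (γ , 0) ∉ T → Adds T γ m (just (γ , 0))
  s1b : ∀ {γ m} → NoDiag T γ m → (γ , 0) ∈ T → (γ , 1) ∉ T → Adds T γ m nothing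
  s1c : ∀ {γ m r} → NoDiag T γ m → (γ , 0) ∈ T → (γ , 1) ∈ T →
        Adds T (suc γ) (suc γ) r → Adds T γ m r
  s2a : ∀ {γ m i j} → FirstDiag T γ m i j → (i , suc j) ∉ T →
        Adds T γ m (just (i , suc j))
  s2b : ∀ {γ m i j} → FirstDiag T γ m i j → (i , suc j) ∈ T →
        (i , suc (suc j)) ∉ T → Adds T γ m nothing
  s2c : ∀ {γ m i j r} → FirstDiag T γ m i j → (i , suc j) ∈ T →
        (i , suc (suc j)) ∈ T → Adds T (suc γ) (suc i) r → Adds T γ m r

outcome : Diagram → Maybe Cell → Outcome
outcome T nothing  = stuck
outcome T (just c) = done (c ∷ T)

Adds⇒P : ∀ {T γ m r} → Adds T γ m r → P T γ m (outcome T r)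
Adds⇒P (s1a nd n0)       = s1a nd n0
Adds⇒P (s1b nd y0 n1)    = s1b nd y0 n1
Adds⇒P (s1c nd y0 y1 a)  = s1c nd y0 y1 (Adds⇒P a)
Adds⇒P (s2a fd n1)       = s2a fd n1
Adds⇒P (s2b fd y1 n2)    = s2b fd y1 n2
Adds⇒P (s2c fd y1 y2 a)  = s2c fd y1 y2 (Adds⇒P a)

diagonal⇒< : ∀ {i j γ} → suc (i + j) ≡ γ → i < γ
diagonal⇒< {i} {j} refl = s≤s (m≤m+n i j)

Adds-column≥ : ∀ {T γ m c} → m ≤ γ → Adds T γ m (just c) → m ≤ proj₁ c
Adds-column≥ m≤γ (s1a _ _)                  = m≤γ
Adds-column≥ m≤γ (s1c _ _ _ a)              =
  ≤-trans m≤γ (≤-trans (n≤1+n _) (Adds-column≥ ≤-refl a))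
Adds-column≥ m≤γ (s2a (m≤i , _) _)          = m≤i
Adds-column≥ m≤γ (s2c (m≤i , e , _) _ _ a) =
  ≤-trans m≤i (≤-trans (n≤1+n _) (Adds-column≥ (m≤n⇒m≤1+n (diagonal⇒< e)) a))

∈-cons-left : ∀ {T : Diagram} {i j i' j'} → i < i' → (i' , j') ∈ (i , j) ∷ T → (i' , j') ∈ T
∈-cons-left i<i' (here refl) = ⊥-elim (<-irrefl refl i<i')
∈-cons-left _    (there x)   = x

NoDiag-cons-left : ∀ {T γ m i j} → i < m → NoDiag T γ m → NoDiag ((i , j) ∷ T) γ m
NoDiag-cons-left i<m nd i' j' m≤i' e x = nd i' j' m≤i' e (∈-cons-left (<-≤-trans i<m m≤i') x)

FirstDiag-cons-left : ∀ {T γ m i j i' j'} → i < m →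
  FirstDiag T γ m i' j' → FirstDiag ((i , j) ∷ T) γ m i' j'
FirstDiag-cons-left i<m (m≤i' , e , x , first) =
  m≤i' , e , there x ,
  λ i'' j'' m≤i'' lt e' y → first i'' j'' m≤i'' lt e' (∈-cons-left (<-≤-trans i<m m≤i'') y)

Adds-cons-left : ∀ {T γ m r i j} → i < m → m ≤ γ → Adds T γ m r → Adds ((i , j) ∷ T) γ m r
Adds-cons-left i<m m≤γ (s1a nd n0) =
  s1a (NoDiag-cons-left i<m nd) (λ y → n0 (∈-cons-left (<-≤-trans i<m m≤γ) y))
Adds-cons-left i<m m≤γ (s1b nd y0 n1) =
  s1b (NoDiag-cons-left i<m nd) (there y0) (λ y → n1 (∈-cons-left (<-≤-trans i<m m≤γ) y))
Adds-cons-left i<m m≤γ (s1c nd y0 y1 a) =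
  s1c (NoDiag-cons-left i<m nd) (there y0) (there y1)
      (Adds-cons-left (m<n⇒m<1+n (<-≤-trans i<m m≤γ)) ≤-refl a)
Adds-cons-left i<m m≤γ (s2a fd@(m≤i' , _) n1) =
  s2a (FirstDiag-cons-left i<m fd) (λ y → n1 (∈-cons-left (<-≤-trans i<m m≤i') y))
Adds-cons-left i<m m≤γ (s2b fd@(m≤i' , _) y1 n2) =
  s2b (FirstDiag-cons-left i<m fd) (there y1) (λ y → n2 (∈-cons-left (<-≤-trans i<m m≤i') y))
Adds-cons-left i<m m≤γ (s2c fd@(m≤i' , e , _) y1 y2 a) =
  s2c (FirstDiag-cons-left i<m fd) (there y1) (there y2)
      (Adds-cons-left (m<n⇒m<1+n (<-≤-trans i<m m≤i')) (m≤n⇒m≤1+n (diagonal⇒< e)) a)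

record Height (T : Diagram) (m h : ℕ) : Set where
  field
    below  : ∀ {j} → (m , j) ∈ T → j < h
    filled : ∀ {j} → j < h → (m , j) ∈ T
open Height

Heights : Diagram → Set
Heights T = ∀ m → ∃ (Height T m)

Height-cons-other : ∀ {T m h i j} → i ≢ m → Height T m h → Height ((i , j) ∷ T) m h
Height-cons-other i≢m H = record
  { below  = λ { (here refl) → ⊥-elim (i≢m refl) ; (there x) → below H x }
  ; filled = λ j<h → there (filled H j<h) }

Height-cons-top : ∀ {T m h} → Height T m h → Height ((m , h) ∷ T) m (suc h)
Height-cons-top {T} {m} {h} H = record { below = below′ ; filled = filled′ }
  where
  below′ : ∀ {j} → (m , j) ∈ (m , h) ∷ T → j < suc h
  below′ (here refl) = ≤-refl
  below′ (there x)   = m≤n⇒m≤1+n (below H x)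
  filled′ : ∀ {j} → j < suc h → (m , j) ∈ (m , h) ∷ T
  filled′ j<1+h with m≤n⇒m<n∨m≡n (≤-pred j<1+h)
  ... | inj₁ j<h  = there (filled H j<h)
  ... | inj₂ refl = here refl

Height-after : ∀ {U m h a c} → suc m ≤ a → Height U m h → Adds U a (suc m) (just c) →
  Height (c ∷ U) m h
Height-after m<a H a = Height-cons-other (λ { refl → <-irrefl refl (Adds-column≥ m<a a) }) H

height-below : ∀ {T} → (∀ i j k → (i , j) ∈ T → k ≤ j → (i , k) ∈ T) →
  ∀ m n → (∀ {j} → (m , j) ∈ T → j < n) → ∃ (Height T m)
height-below closed m zero below′ = 0 , record { below = below′ ; filled = λ () }
height-below {T} closed m (suc n) below′ with (m , n) ∈? T
... | yes x = suc n , record { below = below′ ; filled = λ k<1+n → closed m n _ x (≤-pred k<1+n) }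
... | no ¬x = height-below closed m n below″
  where
  below″ : ∀ {j} → (m , j) ∈ T → j < n
  below″ {j} y with m≤n⇒m<n∨m≡n (≤-pred (below′ y))
  ... | inj₁ j<n  = j<n
  ... | inj₂ refl = ⊥-elim (¬x y)

bounded : (f : Cell → ℕ) (T : Diagram) → ∃ λ N → ∀ {c} → c ∈ T → f c < N
bounded f []      = 0 , λ ()
bounded f (c ∷ T) with bounded f T
... | N , B = suc (f c) ⊔ N , λ { (here refl) → m≤m⊔n _ N ; (there x) → ≤-trans (B x) (m≤n⊔m _ N) }

tower-heights : ∀ {T} → IsTowerDiagram T → Heights T
tower-heights {T} (_ , closed) m =
  height-below closed m (proj₁ (bounded proj₂ T)) (proj₂ (bounded proj₂ T))

Bounded : Diagram → ℕ → Set
Bounded T N = ∀ {c} → c ∈ T → proj₁ c < N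

occupied⇒< : ∀ {T N m h x} → Bounded T N → Height T m h → x < h + m → m ≤ x → m < N
occupied⇒< {h = zero}  B H x<m m≤x = ⊥-elim (<⇒≱ x<m m≤x)
occupied⇒< {h = suc h} B H _   _   = B (filled H z<s)

NoDiag-self : ∀ {T m} → NoDiag T m m
NoDiag-self i j m≤i e _ = <⇒≱ (diagonal⇒< e) m≤i

FirstDiag-self : ∀ {T γ m j} → (m , j) ∈ T → suc (m + j) ≡ γ → FirstDiag T γ m m j
FirstDiag-self x e = ≤-refl , e , x , λ _ _ m≤i' i'<m _ _ → <⇒≱ i'<m m≤i'

column-add : ∀ {T m h x} → Height T m h → h + m ≡ x → Adds T x m (just (m , h))
column-add {h = zero}  H refl = s1a NoDiag-self (λ x → <-irrefl refl (below H x))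
column-add {m = m} {h = suc h} H refl =
  s2a (FirstDiag-self (filled H ≤-refl) (cong suc (+-comm m h))) (λ x → <-irrefl refl (below H x))

column-stuck : ∀ {T m h x} → Height T m h → h + m ≡ suc x → m ≤ x → Adds T x m nothing
column-stuck {h = zero}        H refl m≤x = ⊥-elim (<-irrefl refl m≤x)
column-stuck {h = suc zero}    H refl _   =
  s1b NoDiag-self (filled H z<s) (λ x → <-irrefl refl (below H x))
column-stuck {m = m} {h = suc (suc h)} H refl _ =
  s2b (FirstDiag-self (filled H (n≤1+n (suc h))) (cong suc (+-comm m h)))
      (filled H ≤-refl) (λ x → <-irrefl refl (below H x))

≤⇒≡⊎diagonal : ∀ {m x} → m ≤ x → m ≡ x ⊎ ∃ λ j → suc (m + j) ≡ x
≤⇒≡⊎diagonal {x = zero}  z≤n = inj₁ refl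
≤⇒≡⊎diagonal {x = suc x} z≤n = inj₂ (x , refl)
≤⇒≡⊎diagonal (s≤s m≤x) with ≤⇒≡⊎diagonal m≤x
... | inj₁ e       = inj₁ (cong suc e)
... | inj₂ (j , e) = inj₂ (j , cong suc e)

column-pass : ∀ {T m h x r} → Height T m h → suc (suc x) ≤ h + m → m ≤ x →
  Adds T (suc x) (suc m) r → Adds T x m r
column-pass {m = m} {h} H le m≤x a with ≤⇒≡⊎diagonal m≤x
... | inj₁ refl = s1c NoDiag-self (filled H (≤-trans (n≤1+n _) 2≤h)) (filled H 2≤h) a
  where
  2≤h : 2 ≤ h
  2≤h = +-cancelʳ-≤ m 2 h le
... | inj₂ (j , refl) =
  s2c (FirstDiag-self (filled H (≤-trans (n≤1+n _) (≤-trans (n≤1+n _) 3+j≤h))) refl)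
      (filled H (≤-trans (n≤1+n _) 3+j≤h)) (filled H 3+j≤h) a
  where
  3+j≤h : 3 + j ≤ h
  3+j≤h = +-cancelʳ-≤ m (3 + j) h (subst (λ k → 3 + k ≤ h + m) (+-comm m j) le)

ColumnMisses : Diagram → ℕ → ℕ → Set
ColumnMisses T x m = ∀ j → suc (m + j) ≡ x → (m , j) ∉ T

NoDiag-extend : ∀ {T x m} → ColumnMisses T x m → NoDiag T x (suc m) → NoDiag T x m
NoDiag-extend misses nd i j m≤i e x with m≤n⇒m<n∨m≡n m≤i
... | inj₁ m<i  = nd i j m<i e x
... | inj₂ refl = misses j e x

FirstDiag-extend : ∀ {T x m i j} → ColumnMisses T x m → FirstDiag T x (suc m) i j →
  FirstDiag T x m i j
FirstDiag-extend misses (m<i , e , x , first) = <⇒≤ m<i , e , x , first′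
  where
  first′ : ∀ i' j' → _ ≤ i' → i' < _ → suc (i' + j') ≡ _ → (i' , j') ∉ _
  first′ i' j' m≤i' i'<i e' y with m≤n⇒m<n∨m≡n m≤i'
  ... | inj₁ m<i' = first i' j' m<i' i'<i e' y
  ... | inj₂ refl = misses j' e' y

column-misses : ∀ {T m h x} → Height T m h → h + m < x → ColumnMisses T x m
column-misses {m = m} {h} H lt j refl x =
  <⇒≱ lt (begin
    suc (m + j) ≡⟨ +-suc m j ⟨
    m + suc j   ≤⟨ +-monoʳ-≤ m (below H x) ⟩
    m + h       ≡⟨ +-comm m h ⟩
    h + m       ∎)
  where open ≤-Reasoning

column-skip : ∀ {T m h x r} → Height T m h → h + m < x → Adds T x (suc m) r → Adds T x m r
column-skip H lt (s1a nd n0)       = s1a (NoDiag-extend (column-misses H lt) nd) n0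
column-skip H lt (s1b nd y0 n1)    = s1b (NoDiag-extend (column-misses H lt) nd) y0 n1
column-skip H lt (s1c nd y0 y1 a)  = s1c (NoDiag-extend (column-misses H lt) nd) y0 y1 a
column-skip H lt (s2a fd n1)       = s2a (FirstDiag-extend (column-misses H lt) fd) n1
column-skip H lt (s2b fd y1 n2)    = s2b (FirstDiag-extend (column-misses H lt) fd) y1 n2
column-skip H lt (s2c fd y1 y2 a)  = s2c (FirstDiag-extend (column-misses H lt) fd) y1 y2 a

data Offset (d x : ℕ) : Set where
  <x   : d < x → Offset d x
  ≡x   : d ≡ x → Offset d x
  ≡1+x : d ≡ suc x → Offset d x
  ≡2+x : d ≡ suc (suc x) → Offset d x
  >2+x : suc (suc x) < d → Offset d x

offset : ∀ d x → Offset d x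
offset d x with <-cmp d x
... | tri< d<x _ _ = <x d<x
... | tri≈ _ d≡x _ = ≡x d≡x
... | tri> _ _ x<d with m≤n⇒m<n∨m≡n x<d
...   | inj₂ e = ≡1+x (sym e)
...   | inj₁ 1+x<d with m≤n⇒m<n∨m≡n 1+x<d
...     | inj₂ e     = ≡2+x (sym e)
...     | inj₁ 2+x<d = >2+x 2+x<d

-- Induction along the moves of a slide: to the next column on the same
-- diagonal, or to the next column and the next diagonal. The latter only
-- passes through occupied columns, hence happens at most N times.
column-rec : ∀ N (Φ : ℕ → ℕ → Set) →
  (∀ {m x} → m ≤ x → (m < x → Φ (suc m) x) → (m < N → Φ (suc m) (suc x)) → Φ m x) →
  ∀ {m x} → m ≤ x → Φ m x
column-rec N Φ step = go _ ≤-refl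
  where
  go : ∀ k {m x} → (N ∸ m) + (x ∸ m) < k → m ≤ x → Φ m x
  go (suc k) {m} {x} lt m≤x = step m≤x
    (λ m<x → go k (<-≤-trans (+-mono-≤-< (∸-monoʳ-≤ N (n≤1+n m)) (∸-monoʳ-< ≤-refl m<x)) (≤-pred lt)) m<x)
    (λ m<N → go k (<-≤-trans (+-monoˡ-< (x ∸ m) (∸-monoʳ-< ≤-refl m<N)) (≤-pred lt)) (s≤s m≤x))

Adds-total : ∀ {T N} → Heights T → Bounded T N → ∀ {m x} → m ≤ x → ∃ (Adds T x m)
Adds-total {T} {N} H B = column-rec N (λ m x → ∃ (Adds T x m)) step
  where
  step : ∀ {m x} → m ≤ x → (m < x → ∃ (Adds T x (suc m))) →
    (m < N → ∃ (Adds T (suc x) (suc m))) → ∃ (Adds T x m)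
  step {m} {x} m≤x skip pass with H m
  ... | h , Hm with offset (h + m) x
  ... | <x lt   = let r , a = skip (≤-<-trans (m≤n+m m h) lt) in r , column-skip Hm lt a
  ... | ≡x e    = _ , column-add Hm e
  ... | ≡1+x e  = _ , column-stuck Hm e m≤x
  ... | ≡2+x e  = let r , a = pass (occupied⇒< B Hm (<⇒≤ le) m≤x) in r , column-pass Hm le m≤x a
    where le = ≤-reflexive (sym e)
  ... | >2+x lt = let r , a = pass (occupied⇒< B Hm (<⇒≤ le) m≤x) in r , column-pass Hm le m≤x a
    where le = <⇒≤ lt

data Adds₃ (T : Diagram) (a b c m : ℕ) : Outcome → Set where
  added  : ∀ {c₁ c₂ c₃} → Adds T a m (just c₁) → Adds (c₁ ∷ T) b m (just c₂) →
           Adds (c₂ ∷ c₁ ∷ T) c m (just c₃) → Adds₃ T a b c m (done (c₃ ∷ c₂ ∷ c₁ ∷ T))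
  stuck₁ : Adds T a m nothing → Adds₃ T a b c m stuck
  stuck₂ : ∀ {c₁} → Adds T a m (just c₁) → Adds (c₁ ∷ T) b m nothing → Adds₃ T a b c m stuck
  stuck₃ : ∀ {c₁ c₂} → Adds T a m (just c₁) → Adds (c₁ ∷ T) b m (just c₂) →
           Adds (c₂ ∷ c₁ ∷ T) c m nothing → Adds₃ T a b c m stuck

Adds₃⇒Slides : ∀ {T a b c o} → Adds₃ T a b c 1 o → Slides (a ∷ b ∷ c ∷ []) T o
Adds₃⇒Slides (added a b c)  = consOk (Adds⇒P a) (consOk (Adds⇒P b) (consOk (Adds⇒P c) nil))
Adds₃⇒Slides (stuck₁ a)     = consStop (Adds⇒P a)
Adds₃⇒Slides (stuck₂ a b)   = consOk (Adds⇒P a) (consStop (Adds⇒P b))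
Adds₃⇒Slides (stuck₃ a b c) = consOk (Adds⇒P a) (consOk (Adds⇒P b) (consStop (Adds⇒P c)))

Lifts : ℕ → ℕ → ℕ → ℕ → Set
Lifts m h a a' = ∀ {U r} → Height U m h → Adds U a' (suc m) r → Adds U a m r

Adds₃-lift : ∀ {T m h a b c a' b' c' o} → Height T m h → suc m ≤ a' → suc m ≤ b' →
  Lifts m h a a' → Lifts m h b b' → Lifts m h c c' →
  Adds₃ T a' b' c' (suc m) o → Adds₃ T a b c m o
Adds₃-lift H m<a' m<b' la lb lc (added a b c) =
  added (la H a) (lb H₁ b) (lc (Height-after m<b' H₁ b) c)
  where H₁ = Height-after m<a' H a
Adds₃-lift H m<a' m<b' la lb lc (stuck₁ a)     = stuck₁ (la H a)
Adds₃-lift H m<a' m<b' la lb lc (stuck₂ a b)   = stuck₂ (la H a) (lb (Height-after m<a' H a) b)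
Adds₃-lift H m<a' m<b' la lb lc (stuck₃ a b c) =
  stuck₃ (la H a) (lb H₁ b) (lc (Height-after m<b' H₁ b) c)
  where H₁ = Height-after m<a' H a

Commutes : Diagram → ℕ → ℕ → Set
Commutes T x m =
  (∃₂ λ A B → Adds₃ T x (suc x) x m (done A) × Adds₃ T (suc x) x (suc x) m (done B) × A ≐ B)
  ⊎ (Adds₃ T x (suc x) x m stuck × Adds₃ T (suc x) x (suc x) m stuck)

Commutes-lift : ∀ {T m h x x'} → Height T m h → suc m ≤ x' →
  Lifts m h x x' → Lifts m h (suc x) (suc x') → Commutes T x' (suc m) → Commutes T x m
Commutes-lift H m<x' l l₁ (inj₁ (A , B , a , b , A≐B)) =
  inj₁ (A , B , Adds₃-lift H m<x' (m≤n⇒m≤1+n m<x') l l₁ l a ,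
                Adds₃-lift H (m≤n⇒m≤1+n m<x') m<x' l₁ l l₁ b , A≐B)
Commutes-lift H m<x' l l₁ (inj₂ (a , b)) =
  inj₂ (Adds₃-lift H m<x' (m≤n⇒m≤1+n m<x') l l₁ l a ,
        Adds₃-lift H (m≤n⇒m≤1+n m<x') m<x' l₁ l l₁ b)

↭⇒≐ : ∀ {A B} → A ↭ B → A ≐ B
↭⇒≐ A↭B c = mk⇔ (∈-resp-↭ A↭B) (∈-resp-↭ (↭-sym A↭B))

commutes-at-top : ∀ {T m h x} → Height T m h → h + m ≡ x →
  ∃ (Adds T (suc x) (suc m)) → Commutes T x m
commutes-at-top {T} {m} {h} H refl (_ , a) = finish a
  where
  H₁ = Height-cons-top H
  then-pass : ∀ {r} → Adds T (suc (h + m)) (suc m) r →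
    Adds ((m , suc h) ∷ (m , h) ∷ T) (h + m) m r
  then-pass a = column-pass (Height-cons-top H₁) ≤-refl (m≤n+m m h)
    (Adds-cons-left ≤-refl (s≤s (m≤n+m m h)) (Adds-cons-left ≤-refl (s≤s (m≤n+m m h)) a))
  finish : ∀ {r} → Adds T (suc (h + m)) (suc m) r → Commutes T (h + m) m
  finish {nothing} a =
    inj₂ (stuck₃ (column-add H refl) (column-add H₁ refl) (then-pass a) ,
          stuck₁ (column-skip H ≤-refl a))
  finish {just c} a =
    inj₁ (_ , _ , added (column-add H refl) (column-add H₁ refl) (then-pass a) ,
                  added (column-skip H ≤-refl a) (column-add H′ refl) (column-add (Height-cons-top H′) refl) ,
                  ↭⇒≐ (↭-sym (shift c ((m , suc h) ∷ (m , h) ∷ []) T)))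
    where H′ = Height-after (s≤s (m≤n+m m h)) H a

commutes-one-above : ∀ {T m h x} → Height T m h → h + m ≡ suc x → m ≤ x →
  ∃ (Adds T (suc x) (suc m)) → Commutes T x m
commutes-one-above {T} {m} {h} {x} H e m≤x (_ , a) =
  inj₂ (stuck₁ (column-stuck H e m≤x) , by-cases (Adds-cons-left ≤-refl (s≤s m≤x) a))
  where
  H₁ = Height-cons-top H
  by-cases : ∀ {r} → Adds ((m , h) ∷ T) (suc x) (suc m) r → Adds₃ T (suc x) x (suc x) m stuck
  by-cases {nothing} a = stuck₂ (column-add H e) (column-pass H₁ (≤-reflexive (sym (cong suc e))) m≤x a)
  by-cases {just c}  a =
    stuck₃ (column-add H e) (column-pass H₁ (≤-reflexive (sym (cong suc e))) m≤x a)
           (column-stuck (Height-after (s≤s m≤x) H₁ a) (cong suc e) (m≤n⇒m≤1+n m≤x))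

commutes-two-above : ∀ {T m h x} → Height T m h → h + m ≡ suc (suc x) → m ≤ x →
  ∃ (Adds T (suc x) (suc m)) → Commutes T x m
commutes-two-above {T} {m} {h} {x} H e m≤x (_ , a) =
  inj₂ (by-cases a , stuck₁ (column-stuck H e (m≤n⇒m≤1+n m≤x)))
  where
  by-cases : ∀ {r} → Adds T (suc x) (suc m) r → Adds₃ T x (suc x) x m stuck
  by-cases {nothing} a = stuck₁ (column-pass H (≤-reflexive (sym e)) m≤x a)
  by-cases {just c}  a =
    stuck₂ (column-pass H (≤-reflexive (sym e)) m≤x a)
           (column-stuck (Height-after (s≤s m≤x) H a) e (m≤n⇒m≤1+n m≤x))

commutes : ∀ {T N} → Heights T → Bounded T N → ∀ {m x} → m ≤ x → Commutes T x m
commutes {T} {N} H B = column-rec N (λ m x → Commutes T x m) step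
  where
  step : ∀ {m x} → m ≤ x → (m < x → Commutes T x (suc m)) →
    (m < N → Commutes T (suc x) (suc m)) → Commutes T x m
  step {m} {x} m≤x skip pass with H m
  ... | h , Hm with offset (h + m) x
  ... | <x lt   = Commutes-lift Hm m<x (λ H′ → column-skip H′ lt) (λ H′ → column-skip H′ (m<n⇒m<1+n lt))
                    (skip m<x)
    where m<x = ≤-<-trans (m≤n+m m h) lt
  ... | ≡x e    = commutes-at-top Hm e (Adds-total H B (s≤s m≤x))
  ... | ≡1+x e  = commutes-one-above Hm e m≤x (Adds-total H B (s≤s m≤x))
  ... | ≡2+x e  = commutes-two-above Hm e m≤x (Adds-total H B (s≤s m≤x))
  ... | >2+x lt = Commutes-lift Hm (s≤s m≤x) (λ H′ → column-pass H′ (<⇒≤ lt) m≤x)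
                    (λ H′ → column-pass H′ lt (m≤n⇒m≤1+n m≤x))
                    (pass (occupied⇒< B Hm (<⇒≤ (<⇒≤ lt)) m≤x))

lemma3p5 : (T : Diagram) → IsTowerDiagram T → (α : ℕ) → 1 ≤ α →
    (Σ Diagram λ A → Σ Diagram λ B →
       Slides (α ∷ suc α ∷ α ∷ []) T (done A) ×
       Slides (suc α ∷ α ∷ suc α ∷ []) T (done B) × A ≐ B)
    ⊎ (Slides (α ∷ suc α ∷ α ∷ []) T stuck ×
       Slides (suc α ∷ α ∷ suc α ∷ []) T stuck)
lemma3p5 T tower α 1≤α with commutes (tower-heights tower) (proj₂ (bounded proj₁ T)) 1≤α
... | inj₁ (A , B , a , b , A≐B) = inj₁ (A , B , Adds₃⇒Slides a , Adds₃⇒Slides b , A≐B)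
... | inj₂ (a , b)               = inj₂ (Adds₃⇒Slides a , Adds₃⇒Slides b)
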